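{- Let $D$ be a strongly connected balanced bipartite digraph of order $2a\geq 8$ with partite sets $X$ and $Y$ such that $\max\{d(x),d(y)\}\geq 2a-2$ for every dominating pair of vertices $\{x,y\}$. Then $D$ contains a perfect matching from $X$ to $Y$ and a perfect matching from $Y$ to $X$. Moreover, $D$ contains a cycle factor.
   Context: Digraphs are finite, without loops or multiple arcs (2-cycles allowed). $d(x)=d^+(x)+d^-(x)$. A pair of distinct vertices $\{x,y\}$ is dominating if there is a vertex $z$ with $x\to z$ and $y\to z$. A matching from $X$ to $Y$ is a set of arcs with tails in $X$, heads in $Y$, no two sharing an endpoint; it is perfect if it has $|X|$ arcs. A cycle factor is a collection of vertex-disjoint directed cycles covering all vertices of $D$. -}

module Defs where

open import Data.Unit using (⊤)
import Data.List
open import Data.Nat using (ℕ; zero; suc; _+_; _∸_; _≤_; _⊔_)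
open import Data.Fin using (Fin; zero; suc)
open import Data.Bool using (Bool; true; false; if_then_else_)
open import Data.List using (List; []; _∷_; length; concat)
open import Data.List.Membership.Propositional using (_∈_)
open import Data.List.Relation.Unary.All using (All)
open import Data.List.Relation.Unary.Unique.Propositional using (Unique)
open import Data.Product using (Σ; _×_; ∃-syntax)
open import Relation.Binary.PropositionalEquality using (_≡_; _≢_)

-- A digraph on the vertex set Fin n, given by a Boolean adjacency relation
-- (arc x → y iff adj x y ≡ true).  No loops; 2-cycles allowed; no multiple arcs
-- (automatic for a relation).
record Digraph (n : ℕ) : Set where
  field
    adj     : Fin n → Fin n → Bool
    loopless : ∀ v → adj v v ≡ false
open Digraph public

Arc : ∀ {n} → Digraph n → Fin n → Fin n → Set
Arc D x y = adj D x y ≡ true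

count : ∀ {n} → (Fin n → Bool) → ℕ
count {zero}  p = 0
count {suc n} p = (if p zero then 1 else 0) + count (λ i → p (suc i))

outdeg indeg deg : ∀ {n} → Digraph n → Fin n → ℕ
outdeg D x = count (λ y → adj D x y)
indeg  D x = count (λ y → adj D y x)
deg    D x = outdeg D x + indeg D x

data Reach {n} (D : Digraph n) : Fin n → Fin n → Set where
  here  : ∀ {x} → Reach D x x
  there : ∀ {x y z} → Arc D x y → Reach D y z → Reach D x z

StronglyConnected : ∀ {n} → Digraph n → Set
StronglyConnected D = ∀ x y → Reach D x y

DominatingPair : ∀ {n} → Digraph n → Fin n → Fin n → Set
DominatingPair D x y = x ≢ y × ∃[ z ] (Arc D x z × Arc D y z)

-- D is a balanced bipartite digraph with partite sets
-- X = {v | side v ≡ true}, Y = {v | side v ≡ false}, each of size a.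
record BalancedBipartite {n} (D : Digraph n) (a : ℕ) (side : Fin n → Bool) : Set where
  field
    sizeX   : count side ≡ a
    sizeY   : count (λ v → if side v then false else true) ≡ a
    bipart  : ∀ x y → Arc D x y → side x ≢ side y

-- Represented by the function assigning to
-- each tail the head of its matching arc (which must be injective).
PerfectMatchingFrom : ∀ {n} → Digraph n → (Fin n → Bool) → Bool → Set
PerfectMatchingFrom {n} D side s =
  Σ (Fin n → Fin n) λ f →
    (∀ x → side x ≡ s → Arc D x (f x) × side (f x) ≢ s) ×
    (∀ x x' → side x ≡ s → side x' ≡ s → f x ≡ f x' → x ≡ x')

IsPathSeq : ∀ {n} → Digraph n → List (Fin n) → Set
IsPathSeq D []           = ⊤
IsPathSeq D (x ∷ [])     = ⊤
IsPathSeq D (x ∷ y ∷ zs) = Arc D x y × IsPathSeq D (y ∷ zs)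

lastOr : ∀ {A : Set} → A → List A → A
lastOr d []       = d
lastOr d (x ∷ xs) = lastOr x xs

-- a directed cycle x₀ → x₁ → … → xₖ → x₀ on distinct vertices (k ≥ 1; a
-- cycle of length 1 would be a loop).  Its vertex list is x₀ ∷ xs.
record Cycle {n} (D : Digraph n) : Set where
  field
    start   : Fin n
    rest    : List (Fin n)
    nontriv : 1 ≤ length rest
    path    : IsPathSeq D (start ∷ rest)
    closing : Arc D (lastOr start rest) start
    distinct : Unique (start ∷ rest)

cycleVertices : ∀ {n} {D : Digraph n} → Cycle D → List (Fin n)
cycleVertices C = Cycle.start C ∷ Cycle.rest C

CycleFactor : ∀ {n} → Digraph n → Set
CycleFactor {n} D = Σ (List (Cycle D)) λ cs →
  Unique (concat (Data.List.map cycleVertices cs)) ×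
  (∀ v → v ∈ concat (Data.List.map cycleVertices cs))

-- By Hall's theorem it suffices to show |N⁺(Q)| ≥ |Q| for every subset Q of one side P, with
-- N⁺(Q) taken in the other side R.  Suppose |N⁺(Q)| < |Q| and put Y = R ∖ N⁺(Q); every
-- in-neighbour of a vertex of Y lies in P ∖ Q, and counting gives |Y| ≥ 2 and |P ∖ Q| ≥ 1.
-- A vertex x ∈ Q with d(x) ≥ 2a − 2 has d⁺(x) ≤ |N⁺(Q)| ≤ a − 2, hence d⁻(x) = a and
-- |P ∖ Q| ≤ 1: so all of Y dominates x, while every vertex of Y has degree at most a + 1,
-- and two vertices of Y form a dominating pair violating the hypothesis.  Thus every vertex
-- of Q has degree below 2a − 2, no two of them share an out-neighbour, and choosing an
-- out-neighbour for each (strong connectivity) injects Q into N⁺(Q), a contradiction.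
-- The two perfect matchings together form an injective successor function x ↦ σ x along
-- arcs, and the orbits of σ are the cycles of a cycle factor.

module Submission where

open import Defs
open import Algebra.Properties.CommutativeSemigroup using (xy∙z≈xz∙y)
open import Data.Bool using (Bool; true; false; _∧_; _∨_; not; if_then_else_)
import Data.Bool.Properties as Bool
open import Data.Fin using (Fin; zero; suc; toℕ)
open import Data.Fin.Properties using (_≟_; suc-injective; 0≢1+n; any?; all?; pigeonhole; toℕ-injective)
open import Data.Fin.Subset.Properties using (anySubset?)
open import Data.List using (List; []; _∷_; map; concat; filter; allFin)
import Data.List as List
open import Data.List.Extrema.Nat using (argmin; argmin-sel; f[argmin]≤f[xs])
open import Data.List.Membership.Propositional using (_∈_)
open import Data.List.Membership.Propositional.Properties using (∈-map⁺; ∈-concat⁺′; ∈-filter⁺; ∈-allFin)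
open import Data.List.Properties using (length-iterate; map-∘)
open import Data.List.Relation.Binary.Disjoint.Propositional using (Disjoint)
open import Data.List.Relation.Unary.All as All using (All; []; _∷_)
import Data.List.Relation.Unary.All.Properties as Allₚ
open import Data.List.Relation.Unary.AllPairs using (AllPairs; []; _∷_)
import Data.List.Relation.Unary.AllPairs.Properties as AllPairs
open import Data.List.Relation.Unary.Any using (here; there)
open import Data.List.Relation.Unary.Unique.Propositional using (Unique)
open import Data.List.Relation.Unary.Unique.Propositional.Properties using (concat⁺; filter⁺; allFin⁺)
open import Data.Nat using (ℕ; zero; suc; pred; _+_; _∸_; _≤_; _<_; _⊔_; z≤n; s≤s; s≤s⁻¹; _≤?_; _<?_)
open import Data.Nat.GeneralisedArithmetic using (iterate)
open import Data.Nat.Properties hiding (_≟_; suc-injective; 0≢1+n)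
open import Data.Product using (Σ; _×_; _,_; ∃-syntax; proj₁; proj₂)
open import Data.Sum using (_⊎_; inj₁; inj₂; [_,_]′)
open import Data.Unit using (tt)
open import Data.Vec using (lookup; tabulate)
open import Data.Vec.Properties using (lookup∘tabulate)
open import Function using (_∘_)
open import Function.Definitions using (Injective)
open import Relation.Nullary using (¬_; Dec; does; yes; no; contradiction)
open import Relation.Nullary.Decidable using (_×-dec_; _→-dec_)
open import Relation.Binary.PropositionalEquality

private variable n m : ℕ

-- Finite sets as Boolean predicates

infix 4 _⊆ᵇ_
_⊆ᵇ_ : (Fin n → Bool) → (Fin n → Bool) → Set
P ⊆ᵇ Q = ∀ x → P x ≡ true → Q x ≡ true

-- Q is tested first, so that P ∖ ⁅ c ⁆ computes on the constructors of Fin.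
infixl 6 _∖_
_∖_ : (Fin n → Bool) → (Fin n → Bool) → Fin n → Bool
(P ∖ Q) x = not (Q x) ∧ P x

infixl 6 _∪_
_∪_ : (Fin n → Bool) → (Fin n → Bool) → Fin n → Bool
(P ∪ Q) x = P x ∨ Q x

⁅_⁆ : Fin n → Fin n → Bool
⁅ c ⁆ x = does (x ≟ c)

⊆-∪ʳ : (P Q : Fin n → Bool) → Q ⊆ᵇ P ∪ Q
⊆-∪ʳ P Q x qx rewrite qx = Bool.∨-zeroʳ (P x)

∪-⊆ : {P Q R : Fin n → Bool} → P ⊆ᵇ R → Q ⊆ᵇ R → P ∪ Q ⊆ᵇ R
∪-⊆ {P = P} P⊆R Q⊆R x h with P x in px
... | true  = P⊆R x px
... | false = Q⊆R x h

∖-intro : (P Q : Fin n → Bool) {x : Fin n} → P x ≡ true → Q x ≡ false → (P ∖ Q) x ≡ true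
∖-intro P Q px qx rewrite qx = px

∖-elim : (P Q : Fin n → Bool) {x : Fin n} → (P ∖ Q) x ≡ true → P x ≡ true × Q x ≡ false
∖-elim P Q {x} h with Q x
... | false = h , refl

⁅⁆-self : (c : Fin n) → ⁅ c ⁆ c ≡ true
⁅⁆-self c with c ≟ c
... | yes _  = refl
... | no c≢c = contradiction refl c≢c

⁅⁆-sound : {c x : Fin n} → ⁅ c ⁆ x ≡ true → x ≡ c
⁅⁆-sound {c = c} {x} h with x ≟ c
... | yes x≡c = x≡c

⁅⁆-⊆ : (P : Fin n → Bool) {c : Fin n} → P c ≡ true → ⁅ c ⁆ ⊆ᵇ P
⁅⁆-⊆ P pc x x≡c = subst (λ z → P z ≡ true) (sym (⁅⁆-sound x≡c)) pc

remove-other : (P : Fin n → Bool) {c x : Fin n} → x ≢ c → (P ∖ ⁅ c ⁆) x ≡ P x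
remove-other P {c} {x} x≢c with x ≟ c
... | yes x≡c = contradiction x≡c x≢c
... | no _    = refl

remove-sound : (P : Fin n → Bool) {c x : Fin n} → (P ∖ ⁅ c ⁆) x ≡ true → x ≢ c × P x ≡ true
remove-sound P {c} {x} h with x ≟ c
... | no x≢c = x≢c , h

count-cong : (P Q : Fin n → Bool) → (∀ x → P x ≡ Q x) → count P ≡ count Q
count-cong {zero}  P Q P≗Q = refl
count-cong {suc n} P Q P≗Q =
  cong₂ _+_ (cong (λ b → if b then 1 else 0) (P≗Q zero)) (count-cong (P ∘ suc) (Q ∘ suc) (P≗Q ∘ suc))

count-⊆ : (Q P : Fin n → Bool) → Q ⊆ᵇ P → count P ≡ count Q + count (P ∖ Q)
count-⊆ {zero}  Q P Q⊆P = refl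
count-⊆ {suc n} Q P Q⊆P with Q zero in q₀ | count-⊆ (Q ∘ suc) (P ∘ suc) (Q⊆P ∘ suc)
... | true  | ih rewrite Q⊆P zero q₀ = cong suc ih
... | false | ih with P zero
...   | true  = trans (cong suc ih) (sym (+-suc _ _))
...   | false = ih

count-∖-< : (Q P : Fin n → Bool) → Q ⊆ᵇ P → 0 < count Q → count (P ∖ Q) < count P
count-∖-< Q P Q⊆P 0<|Q| = subst (count (P ∖ Q) <_) (sym (count-⊆ Q P Q⊆P)) (+-monoˡ-< (count (P ∖ Q)) 0<|Q|)

count-remove : (P : Fin n → Bool) (c : Fin n) → count P ≡ (if P c then 1 else 0) + count (P ∖ ⁅ c ⁆)
count-remove {suc n} P zero    = refl
count-remove {suc n} P (suc c) with P zero | count-remove (P ∘ suc) c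
... | true  | ih = trans (cong suc ih) (sym (+-suc _ _))
... | false | ih = ih

count-≤-remove : (P : Fin n → Bool) (c : Fin n) → count P ≤ suc (count (P ∖ ⁅ c ⁆))
count-≤-remove P c rewrite count-remove P c with P c
... | true  = ≤-refl
... | false = n≤1+n _

count-witness : (P : Fin n → Bool) → 0 < count P → ∃[ x ] P x ≡ true
count-witness {suc n} P 0<|P| with P zero in p₀
... | true  = zero , p₀
... | false = let x , px = count-witness (P ∘ suc) 0<|P| in suc x , px

count-pos : (P : Fin n → Bool) {x : Fin n} → P x ≡ true → 0 < count P
count-pos P {x} px rewrite count-remove P x | px = s≤s z≤n

count-⁅⁆ : (c : Fin n) → 0 < count ⁅ c ⁆
count-⁅⁆ c = count-pos ⁅ c ⁆ {c} (⁅⁆-self c)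

count-two : (P : Fin n → Bool) → 2 ≤ count P → ∃[ x ] ∃[ y ] x ≢ y × P x ≡ true × P y ≡ true
count-two P 2≤|P| with count-witness P (≤-trans (s≤s z≤n) 2≤|P|)
... | x , px with count-witness (P ∖ ⁅ x ⁆) (s≤s⁻¹ (subst (2 ≤_) |P|≡1+|P∖x| 2≤|P|))
  where
  |P|≡1+|P∖x| : count P ≡ 1 + count (P ∖ ⁅ x ⁆)
  |P|≡1+|P∖x| rewrite count-remove P x | px = refl
... | y , py = let y≢x , py′ = remove-sound P py in x , y , y≢x ∘ sym , px , py′

count-injective : (P : Fin n → Bool) (Q : Fin m → Bool) (g : Fin n → Fin m) →
  (∀ x → P x ≡ true → Q (g x) ≡ true) →
  (∀ x y → P x ≡ true → P y ≡ true → g x ≡ g y → x ≡ y) →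
  count P ≤ count Q
count-injective {zero}  P Q g maps inj = z≤n
count-injective {suc n} P Q g maps inj with P zero in p₀
... | false = count-injective (P ∘ suc) Q (g ∘ suc) (maps ∘ suc)
                (λ x y px py gx≡gy → suc-injective (inj (suc x) (suc y) px py gx≡gy))
... | true rewrite count-remove Q (g zero) | maps zero p₀ =
  s≤s (count-injective (P ∘ suc) (Q ∖ ⁅ g zero ⁆) (g ∘ suc) maps′
         (λ x y px py gx≡gy → suc-injective (inj (suc x) (suc y) px py gx≡gy)))
  where
  maps′ : ∀ x → P (suc x) ≡ true → (Q ∖ ⁅ g zero ⁆) (g (suc x)) ≡ true
  maps′ x px = trans (remove-other Q (λ g≡ → 0≢1+n (sym (inj (suc x) zero px p₀ g≡))))
                     (maps (suc x) px)

count-mono : (P Q : Fin n → Bool) → P ⊆ᵇ Q → count P ≤ count Q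
count-mono P Q P⊆Q = count-injective P Q (λ x → x) P⊆Q (λ _ _ _ _ x≡y → x≡y)

count-≤⇒⊇ : (P Q : Fin n → Bool) → P ⊆ᵇ Q → count Q ≤ count P → Q ⊆ᵇ P
count-≤⇒⊇ P Q P⊆Q |Q|≤|P| y qy with P y in py
... | true  = refl
... | false = contradiction |Q|≤|P| (<⇒≱ (begin-strict
    count P                   ≡⟨ +-identityʳ (count P) ⟨
    count P + 0               <⟨ +-monoʳ-< (count P) (count-pos (Q ∖ P) (Q∖P[y])) ⟩
    count P + count (Q ∖ P)   ≡⟨ count-⊆ P Q P⊆Q ⟨
    count Q                   ∎))
  where
  open ≤-Reasoning
  Q∖P[y] : (Q ∖ P) y ≡ true
  Q∖P[y] rewrite py = qy

-- Hall's theorem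

module Hall {n : ℕ} (E : Fin n → Fin n → Bool) where

  adjacent? : (Q : Fin n → Bool) (y : Fin n) → Dec (∃[ x ] Q x ≡ true × E x y ≡ true)
  adjacent? Q y = any? λ x → (Q x Bool.≟ true) ×-dec (E x y Bool.≟ true)

  N : (R Q : Fin n → Bool) → Fin n → Bool
  N R Q y = R y ∧ does (adjacent? Q y)

  N-intro : (R Q : Fin n → Bool) {x y : Fin n} → R y ≡ true → Q x ≡ true → E x y ≡ true → N R Q y ≡ true
  N-intro R Q {x} {y} ry qx exy rewrite ry with adjacent? Q y
  ... | yes _  = refl
  ... | no ¬xy = contradiction (x , qx , exy) ¬xy

  N-elim : (R Q : Fin n → Bool) {y : Fin n} → N R Q y ≡ true → R y ≡ true × ∃[ x ] Q x ≡ true × E x y ≡ true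
  N-elim R Q {y} h with R y | adjacent? Q y
  ... | true | yes xy = refl , xy

  N-mono : {R R′ Q Q′ : Fin n → Bool} → R ⊆ᵇ R′ → Q ⊆ᵇ Q′ → N R Q ⊆ᵇ N R′ Q′
  N-mono {R} {R′} {Q} {Q′} R⊆R′ Q⊆Q′ y h =
    let ry , x , qx , exy = N-elim R Q h in N-intro R′ Q′ (R⊆R′ y ry) (Q⊆Q′ x qx) exy

  N-⊆ : (R Q : Fin n → Bool) → N R Q ⊆ᵇ R
  N-⊆ R Q y h = let ry , _ = N-elim R Q h in ry

  Matching : (P R : Fin n → Bool) → Set
  Matching P R = Σ (Fin n → Fin n) λ f →
    (∀ x → P x ≡ true → R (f x) ≡ true × E x (f x) ≡ true) ×
    (∀ x x′ → P x ≡ true → P x′ ≡ true → f x ≡ f x′ → x ≡ x′)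

  HallCondition : (P R : Fin n → Bool) → Set
  HallCondition P R = ∀ Q → Q ⊆ᵇ P → count Q ≤ count (N R Q)

  matching-empty : (P R : Fin n → Bool) → count P ≡ 0 → Matching P R
  matching-empty P R |P|≡0 = (λ x → x) , (λ x px → absurd px) , (λ x _ px _ _ → absurd px)
    where
    absurd : ∀ {A : Set} {x} → P x ≡ true → A
    absurd px = contradiction (subst (0 <_) |P|≡0 (count-pos P px)) λ ()

  matching-singleton : {x y : Fin n} → E x y ≡ true → Matching ⁅ x ⁆ ⁅ y ⁆
  matching-singleton {x} {y} exy =
      (λ _ → y)
    , (λ x′ x′≡x → ⁅⁆-self y , subst (λ z → E z y ≡ true) (sym (⁅⁆-sound x′≡x)) exy)
    , (λ x₁ x₂ x₁≡x x₂≡x _ → trans (⁅⁆-sound x₁≡x) (sym (⁅⁆-sound x₂≡x)))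

  matching-∖ : {P Q R R₁ : Fin n → Bool} → R₁ ⊆ᵇ R →
    Matching Q R₁ → Matching (P ∖ Q) (R ∖ R₁) → Matching P R
  matching-∖ {P} {Q} {R} {R₁} R₁⊆R (f₁ , maps₁ , injective₁) (f₂ , maps₂ , injective₂) = f , maps , injective
    where
    f : Fin n → Fin n
    f x = if Q x then f₁ x else f₂ x

    maps : ∀ x → P x ≡ true → R (f x) ≡ true × E x (f x) ≡ true
    maps x px with Q x in qx
    ... | true  = let r₁ , e = maps₁ x qx in R₁⊆R (f₁ x) r₁ , e
    ... | false = let r₂ , e = maps₂ x (∖-intro P Q px qx) in proj₁ (∖-elim R R₁ r₂) , e

    apart : ∀ {x x′} → Q x ≡ true → (P ∖ Q) x′ ≡ true → f₁ x ≢ f₂ x′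
    apart {x} {x′} qx px′ f₁x≡f₂x′ =
      let r₁ , _ = maps₁ x qx ; _ , r₁′ = ∖-elim R R₁ (proj₁ (maps₂ x′ px′)) in
      contradiction (trans (sym r₁) (trans (cong R₁ f₁x≡f₂x′) r₁′)) λ ()

    injective : ∀ x x′ → P x ≡ true → P x′ ≡ true → f x ≡ f x′ → x ≡ x′
    injective x x′ px px′ fx≡fx′ with Q x in qx | Q x′ in qx′
    ... | true  | true  = injective₁ x x′ qx qx′ fx≡fx′
    ... | false | false = injective₂ x x′ (∖-intro P Q px qx) (∖-intro P Q px′ qx′) fx≡fx′
    ... | true  | false = contradiction fx≡fx′ (apart qx (∖-intro P Q px′ qx′))
    ... | false | true  = contradiction (sym fx≡fx′) (apart qx′ (∖-intro P Q px qx))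

  hall-⊆ : {P R Q : Fin n → Bool} → HallCondition P R → Q ⊆ᵇ P → HallCondition Q (N R Q)
  hall-⊆ {P} {R} {Q} hallPR Q⊆P Q′ Q′⊆Q = begin
    count Q′              ≤⟨ hallPR Q′ (λ x → Q⊆P x ∘ Q′⊆Q x) ⟩
    count (N R Q′)        ≤⟨ count-mono (N R Q′) (N (N R Q) Q′) N⊆N ⟩
    count (N (N R Q) Q′)  ∎
    where
    open ≤-Reasoning
    N⊆N : N R Q′ ⊆ᵇ N (N R Q) Q′
    N⊆N y h = let ry , x , q′x , exy = N-elim R Q′ h in
      N-intro (N R Q) Q′ (N-intro R Q ry (Q′⊆Q x q′x) exy) q′x exy

  hall-∖ : {P R Q : Fin n → Bool} → HallCondition P R → Q ⊆ᵇ P → count (N R Q) ≤ count Q →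
    HallCondition (P ∖ Q) (R ∖ N R Q)
  hall-∖ {P} {R} {Q} hallPR Q⊆P |NQ|≤|Q| T T⊆P∖Q = +-cancelˡ-≤ (count Q) (count T) _ (begin
    count Q + count T                              ≡⟨ cong (count Q +_) (count-cong T ((T ∪ Q) ∖ Q) T≗[T∪Q]∖Q) ⟩
    count Q + count ((T ∪ Q) ∖ Q)                  ≡⟨ count-⊆ Q (T ∪ Q) (⊆-∪ʳ T Q) ⟨
    count (T ∪ Q)                                  ≤⟨ hallPR (T ∪ Q) T∪Q⊆P ⟩
    count (N R (T ∪ Q))
      ≡⟨ count-⊆ (N R Q) (N R (T ∪ Q)) (N-mono (λ _ r → r) (⊆-∪ʳ T Q)) ⟩
    count (N R Q) + count (N R (T ∪ Q) ∖ N R Q)    ≤⟨ +-mono-≤ |NQ|≤|Q| (count-mono _ _ new⊆N) ⟩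
    count Q + count (N (R ∖ N R Q) T)              ∎)
    where
    open ≤-Reasoning
    T∩Q : ∀ x → T x ≡ true → Q x ≡ false
    T∩Q x tx = proj₂ (∖-elim P Q (T⊆P∖Q x tx))
    T≗[T∪Q]∖Q : ∀ x → T x ≡ ((T ∪ Q) ∖ Q) x
    T≗[T∪Q]∖Q x with T x in tx
    ... | true  rewrite T∩Q x tx = refl
    ... | false = sym (Bool.∧-inverseˡ (Q x))
    T∪Q⊆P : T ∪ Q ⊆ᵇ P
    T∪Q⊆P = ∪-⊆ (λ x tx → proj₁ (∖-elim P Q (T⊆P∖Q x tx))) Q⊆P
    new⊆N : N R (T ∪ Q) ∖ N R Q ⊆ᵇ N (R ∖ N R Q) T
    new⊆N y h with ∖-elim (N R (T ∪ Q)) (N R Q) h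
    ... | y∈N[T∪Q] , y∉N[Q] with N-elim R (T ∪ Q) y∈N[T∪Q]
    ...   | ry , x , x∈T∪Q , exy with Q x in qx
    ...     | true  = contradiction (trans (sym y∉N[Q]) (N-intro R Q ry qx exy)) λ ()
    ...     | false = N-intro (R ∖ N R Q) T (∖-intro R (N R Q) ry y∉N[Q])
                        (trans (sym (Bool.∨-identityʳ (T x))) x∈T∪Q) exy

  Tight : (P R Q : Fin n → Bool) → Set
  Tight P R Q = Q ⊆ᵇ P × 0 < count Q × count Q < count P × count (N R Q) ≤ count Q

  Surplus : (P R : Fin n → Bool) → Set
  Surplus P R = ∀ Q → Q ⊆ᵇ P → 0 < count Q → count Q < count P → count Q < count (N R Q)

  tight? : (P R Q : Fin n → Bool) → Dec (Tight P R Q)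
  tight? P R Q = all? (λ x → (Q x Bool.≟ true) →-dec (P x Bool.≟ true))
    ×-dec 0 <? count Q ×-dec count Q <? count P ×-dec count (N R Q) ≤? count Q

  tight-or-surplus : (P R : Fin n → Bool) → (∃[ Q ] Tight P R Q) ⊎ Surplus P R
  tight-or-surplus P R with anySubset? (tight? P R ∘ lookup)
  ... | yes (S , tight) = inj₁ (lookup S , tight)
  ... | no ¬tight = inj₂ surplus
    where
    surplus : Surplus P R
    surplus Q Q⊆P 0<|Q| |Q|<|P| = ≰⇒> λ |NQ|≤|Q| → ¬tight (tabulate Q ,
        (λ x h → Q⊆P x (trans (sym (lookup∘tabulate Q x)) h))
      , subst (0 <_) |Q|≡|Q′| 0<|Q|
      , subst (_< count P) |Q|≡|Q′| |Q|<|P|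
      , ≤-trans (count-mono _ _ (N-mono (λ _ r → r) (λ x h → trans (sym (lookup∘tabulate Q x)) h)))
                (subst (count (N R Q) ≤_) |Q|≡|Q′| |NQ|≤|Q|))
      where
      |Q|≡|Q′| : count Q ≡ count (lookup (tabulate Q))
      |Q|≡|Q′| = count-cong Q _ (λ x → sym (lookup∘tabulate Q x))

  N-∖ : (R Q S : Fin n → Bool) → N R Q ∖ S ⊆ᵇ N (R ∖ S) Q
  N-∖ R Q S y h = let y∈NQ , y∉S = ∖-elim (N R Q) S h ; ry , x , qx , exy = N-elim R Q y∈NQ in
    N-intro (R ∖ S) Q (∖-intro R S ry y∉S) qx exy

  hall-remove : {P R : Fin n → Bool} → Surplus P R → {x : Fin n} → P x ≡ true → (y : Fin n) →
    HallCondition (P ∖ ⁅ x ⁆) (R ∖ ⁅ y ⁆)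
  hall-remove {P} {R} surplus {x} px y Q Q⊆P∖x with 0 <? count Q
  ... | no |Q|≡0 = ≤-trans (≮⇒≥ |Q|≡0) z≤n
  ... | yes 0<|Q| = s≤s⁻¹ (begin
    suc (count Q)                  ≤⟨ surplus Q Q⊆P 0<|Q| |Q|<|P| ⟩
    count (N R Q)                  ≤⟨ count-≤-remove (N R Q) y ⟩
    suc (count (N R Q ∖ ⁅ y ⁆))    ≤⟨ s≤s (count-mono _ _ (N-∖ R Q ⁅ y ⁆)) ⟩
    suc (count (N (R ∖ ⁅ y ⁆) Q))  ∎)
    where
    open ≤-Reasoning
    Q⊆P : Q ⊆ᵇ P
    Q⊆P z qz = proj₁ (∖-elim P ⁅ x ⁆ (Q⊆P∖x z qz))
    |Q|<|P| : count Q < count P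
    |Q|<|P| = ≤-<-trans (count-mono Q (P ∖ ⁅ x ⁆) Q⊆P∖x)
                        (count-∖-< ⁅ x ⁆ P (⁅⁆-⊆ P px) (count-⁅⁆ x))

  hall-edge : {P R : Fin n → Bool} → HallCondition P R → {x : Fin n} → P x ≡ true →
    ∃[ y ] R y ≡ true × E x y ≡ true
  hall-edge {P} {R} hallPR {x} px
    with count-witness (N R ⁅ x ⁆) (<-≤-trans (count-⁅⁆ x) (hallPR ⁅ x ⁆ (⁅⁆-⊆ P px)))
  ... | y , h with N-elim R ⁅ x ⁆ h
  ...   | ry , x′ , x′≡x , ex′y = y , ry , subst (λ z → E z y ≡ true) (⁅⁆-sound x′≡x) ex′y

  -- Halmos–Vaughan induction: either some nonempty proper Q ⊂ P is tight, and Q is matched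
  -- into N(Q) and P ∖ Q into the rest, or every such Q has a surplus and any edge x y can be
  -- matched, deleting x and y.
  hall-step : {P R : Fin n → Bool} →
    (∀ P′ R′ → count P′ < count P → HallCondition P′ R′ → Matching P′ R′) →
    0 < count P → HallCondition P R → Matching P R
  hall-step {P} {R} smaller 0<|P| hallPR with tight-or-surplus P R
  ... | inj₁ (Q , Q⊆P , 0<|Q| , |Q|<|P| , |NQ|≤|Q|) =
    matching-∖ (N-⊆ R Q)
      (smaller Q (N R Q) |Q|<|P| (hall-⊆ hallPR Q⊆P))
      (smaller (P ∖ Q) (R ∖ N R Q) (count-∖-< Q P Q⊆P 0<|Q|) (hall-∖ hallPR Q⊆P |NQ|≤|Q|))
  ... | inj₂ surplus with count-witness P 0<|P|
  ...   | x , px with hall-edge hallPR px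
  ...     | y , ry , exy =
    matching-∖ (⁅⁆-⊆ R ry) (matching-singleton exy)
      (smaller (P ∖ ⁅ x ⁆) (R ∖ ⁅ y ⁆) (count-∖-< ⁅ x ⁆ P (⁅⁆-⊆ P px) (count-⁅⁆ x))
        (hall-remove surplus px y))

  hall-bounded : ∀ k (P R : Fin n → Bool) → count P ≤ k → HallCondition P R → Matching P R
  hall-bounded zero P R |P|≤0 _ = matching-empty P R (n≤0⇒n≡0 |P|≤0)
  hall-bounded (suc k) P R |P|≤1+k with 0 <? count P
  ... | no ¬0<|P| = λ _ → matching-empty P R (n≤0⇒n≡0 (≮⇒≥ ¬0<|P|))
  ... | yes 0<|P| =
    hall-step (λ P′ R′ |P′|<|P| → hall-bounded k P′ R′ (s≤s⁻¹ (<-≤-trans |P′|<|P| |P|≤1+k))) 0<|P|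

  hall-theorem : {P R : Fin n → Bool} → HallCondition P R → Matching P R
  hall-theorem {P} {R} = hall-bounded (count P) P R ≤-refl

-- Cycle factors from an injective successor function

minimal : {P : ℕ → Set} → (∀ i → Dec (P i)) → ∀ {k} → P k → ∃[ m ] P m × (∀ j → j < m → ¬ P j)
minimal {P} P? {k} pk with search (suc k)
  where
  search : ∀ k → (∀ j → j < k → ¬ P j) ⊎ ∃[ m ] P m × (∀ j → j < m → ¬ P j)
  search zero = inj₁ λ _ ()
  search (suc k) with search k
  ... | inj₂ found = inj₂ found
  ... | inj₁ none with P? k
  ...   | yes pk = inj₂ (k , pk , none)
  ...   | no ¬pk = inj₁ λ j j<1+k → [ none j , (λ { refl → ¬pk }) ]′ (m≤n⇒m<n∨m≡n (s≤s⁻¹ j<1+k))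
... | inj₁ none  = contradiction pk (none k ≤-refl)
... | inj₂ found = found

<⇒≡+suc : ∀ {i j} → i < j → ∃[ d ] j ≡ i + suc d
<⇒≡+suc {zero}  {suc j} _         = j , refl
<⇒≡+suc {suc i} {suc j} (s≤s i<j) = let d , j≡ = <⇒≡+suc i<j in d , cong suc j≡

module Successor {n : ℕ} (D : Digraph n) (σ : Fin n → Fin n)
  (σ-arc : ∀ x → Arc D x (σ x)) (σ-injective : Injective _≡_ _≡_ σ) where

  iter : ℕ → Fin n → Fin n
  iter i x = iterate σ x i

  iter-suc : ∀ i x → iter (suc i) x ≡ σ (iter i x)
  iter-suc zero    x = refl
  iter-suc (suc i) x = iter-suc i (σ x)

  iter-+ : ∀ i j x → iter (i + j) x ≡ iter j (iter i x)
  iter-+ zero    j x = refl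
  iter-+ (suc i) j x = iter-+ i j (σ x)

  iter-comm : ∀ i j x → iter i (iter j x) ≡ iter j (iter i x)
  iter-comm i j x = begin
    iter i (iter j x) ≡⟨ iter-+ j i x ⟨
    iter (j + i) x    ≡⟨ cong (λ k → iter k x) (+-comm j i) ⟩
    iter (i + j) x    ≡⟨ iter-+ i j x ⟩
    iter j (iter i x) ∎
    where open ≡-Reasoning

  iter-injective : ∀ i {x y} → iter i x ≡ iter i y → x ≡ y
  iter-injective zero    eq = eq
  iter-injective (suc i) eq = σ-injective (iter-injective i eq)

  iter-collision : ∀ i d v → iter i v ≡ iter (i + suc d) v → iter (suc d) v ≡ v
  iter-collision i d v eq = sym (iter-injective i (trans eq (trans (iter-+ i (suc d) v) (iter-comm (suc d) i v))))

  σ-no-fixpoint : ∀ x → σ x ≢ x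
  σ-no-fixpoint x σx≡x = contradiction (trans (sym (subst (Arc D x) σx≡x (σ-arc x))) (loopless D x)) λ ()

  periodic : ∀ v → ∃[ d ] iter (suc d) v ≡ v
  periodic v with pigeonhole (n<1+n n) (λ i → iter (toℕ i) v)
  ... | i , j , i<j , eq with <⇒≡+suc i<j
  ...   | d , j≡ = d , iter-collision (toℕ i) d v (trans eq (cong (λ k → iter k v) j≡))

  minimalPeriod : ∀ v → ∃[ p ] iter (suc p) v ≡ v × (∀ j → j < p → iter (suc j) v ≢ v)
  minimalPeriod v = let d , back = periodic v in minimal (λ d → iter (suc d) v ≟ v) {d} back

  period : Fin n → ℕ
  period v = suc (proj₁ (minimalPeriod v))

  iter-period : ∀ v → iter (period v) v ≡ v
  iter-period v = proj₁ (proj₂ (minimalPeriod v))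

  orbit : Fin n → List (Fin n)
  orbit v = List.iterate σ v (period v)

  ∈-iterate⁻ : ∀ k {x w} → w ∈ List.iterate σ x k → ∃[ i ] i < k × iter i x ≡ w
  ∈-iterate⁻ (suc k) (here w≡x)  = 0 , s≤s z≤n , sym w≡x
  ∈-iterate⁻ (suc k) (there w∈)  = let i , i<k , eq = ∈-iterate⁻ k w∈ in suc i , s≤s i<k , eq

  ∈-iterate⁺ : ∀ k x {i} → i < k → iter i x ∈ List.iterate σ x k
  ∈-iterate⁺ (suc k) x {zero}  _         = here refl
  ∈-iterate⁺ (suc k) x {suc i} (s≤s i<k) = there (∈-iterate⁺ k (σ x) i<k)

  iterate-unique : ∀ k x → (∀ i j → i < j → j < k → iter i x ≢ iter j x) → Unique (List.iterate σ x k)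
  iterate-unique zero    x distinct = []
  iterate-unique (suc k) x distinct =
    All.tabulate (λ w∈ x≡w → let i , i<k , eq = ∈-iterate⁻ k w∈ in
                   distinct 0 (suc i) (s≤s z≤n) (s≤s i<k) (trans x≡w (sym eq)))
    ∷ iterate-unique k (σ x) (λ i j i<j j<k → distinct (suc i) (suc j) (s≤s i<j) (s≤s j<k))

  iterate-path : ∀ k x → IsPathSeq D (List.iterate σ x k)
  iterate-path zero          x = tt
  iterate-path (suc zero)    x = tt
  iterate-path (suc (suc k)) x = σ-arc x , iterate-path (suc k) (σ x)

  iterate-last : ∀ k x → lastOr x (List.iterate σ (σ x) k) ≡ iter k x
  iterate-last zero    x = refl
  iterate-last (suc k) x = iterate-last k (σ x)

  orbit-unique : ∀ v → Unique (orbit v)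
  orbit-unique v = iterate-unique (period v) v distinct
    where
    distinct : ∀ i j → i < j → j < period v → iter i v ≢ iter j v
    distinct i j i<j j<period eq with <⇒≡+suc i<j
    ... | d , refl = proj₂ (proj₂ (minimalPeriod v)) d
                       (<-≤-trans (n<1+n d) (≤-trans (m≤n+m (suc d) i) (s≤s⁻¹ j<period))) (iter-collision i d v eq)

  period-≥2 : ∀ v → 2 ≤ period v
  period-≥2 v with proj₁ (minimalPeriod v) | iter-period v
  ... | zero  | σv≡v = contradiction σv≡v (σ-no-fixpoint v)
  ... | suc _ | _    = s≤s (s≤s z≤n)

  orbit-cycle : Fin n → Cycle D
  orbit-cycle v = record
    { start    = v
    ; rest     = List.iterate σ (σ v) (pred (period v))
    ; nontriv  = subst (1 ≤_) (sym (length-iterate σ (σ v) _)) (s≤s⁻¹ (period-≥2 v))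
    ; path     = iterate-path (period v) v
    ; closing  = subst₂ (Arc D) (sym (iterate-last p v)) (trans (sym (iter-suc p v)) (iter-period v))
                   (σ-arc (iter p v))
    ; distinct = orbit-unique v
    }
    where p = pred (period v)

  iter-≤-period-∈ : ∀ {i} v → i ≤ period v → iter i v ∈ orbit v
  iter-≤-period-∈ {i} v i≤period with m≤n⇒m<n∨m≡n i≤period
  ... | inj₁ i<period  = ∈-iterate⁺ (period v) v i<period
  ... | inj₂ refl      = subst (_∈ orbit v) (sym (iter-period v)) (here refl)

  iter-∈-orbit : ∀ j v → iter j v ∈ orbit v
  iter-∈-orbit zero    v = here refl
  iter-∈-orbit (suc j) v with ∈-iterate⁻ (period v) (iter-∈-orbit j v)
  ... | i , i<period , iᵥ≡jᵥ =
    subst (_∈ orbit v) (trans (iter-suc i v) (trans (cong σ iᵥ≡jᵥ) (sym (iter-suc j v))))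
          (iter-≤-period-∈ v i<period)

  orbit-sym : ∀ {v w} → w ∈ orbit v → v ∈ orbit w
  orbit-sym {v} {w} w∈ with ∈-iterate⁻ (period v) w∈
  ... | i , i<period , refl = subst (_∈ orbit (iter i v)) back (iter-∈-orbit (period v ∸ i) (iter i v))
    where
    back : iter (period v ∸ i) (iter i v) ≡ v
    back = begin
      iter (period v ∸ i) (iter i v) ≡⟨ iter-+ i (period v ∸ i) v ⟨
      iter (i + (period v ∸ i)) v    ≡⟨ cong (λ k → iter k v) (m+[n∸m]≡n (<⇒≤ i<period)) ⟩
      iter (period v) v              ≡⟨ iter-period v ⟩
      v                              ∎
      where open ≡-Reasoning

  orbit-trans : ∀ {v w u} → w ∈ orbit v → u ∈ orbit w → u ∈ orbit v
  orbit-trans {v} {w} w∈ u∈ with ∈-iterate⁻ (period v) w∈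
  ... | i , _ , refl with ∈-iterate⁻ (period w) u∈
  ...   | j , _ , refl = subst (_∈ orbit v) (iter-+ i j v) (iter-∈-orbit (i + j) v)

  Leader : Fin n → Set
  Leader v = All (λ w → toℕ v ≤ toℕ w) (orbit v)

  leader? : ∀ v → Dec (Leader v)
  leader? v = All.all? (λ w → toℕ v ≤? toℕ w) (orbit v)

  leaders : List (Fin n)
  leaders = filter leader? (allFin n)

  leaders-disjoint : ∀ {r r′} → Leader r → Leader r′ → r ≢ r′ → Disjoint (orbit r) (orbit r′)
  leaders-disjoint {r} {r′} lead lead′ r≢r′ (v∈r , v∈r′) = r≢r′ (toℕ-injective (≤-antisym
    (All.lookup lead  (orbit-trans v∈r  (orbit-sym v∈r′)))
    (All.lookup lead′ (orbit-trans v∈r′ (orbit-sym v∈r)))))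

  leader-of : ∀ v → ∃[ r ] Leader r × v ∈ orbit r
  leader-of v = r , All.tabulate (λ w∈r → All.lookup (f[argmin]≤f[xs] {f = toℕ} v (orbit v)) (orbit-trans r∈v w∈r))
                  , orbit-sym r∈v
    where
    r = argmin toℕ v (orbit v)
    r∈v : r ∈ orbit v
    r∈v = [ (λ r≡v → subst (_∈ orbit v) (sym r≡v) (here refl)) , (λ r∈ → r∈) ]′ (argmin-sel toℕ v (orbit v))

  leaders-pairwise-disjoint : ∀ {rs} → All Leader rs → AllPairs _≢_ rs →
    AllPairs (λ r r′ → Disjoint (orbit r) (orbit r′)) rs
  leaders-pairwise-disjoint []             []                = []
  leaders-pairwise-disjoint (lead ∷ leads) (r≢rs ∷ distinct) =
    disjoint-from leads r≢rs ∷ leaders-pairwise-disjoint leads distinct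
    where
    disjoint-from : ∀ {rs} → All Leader rs → All (_ ≢_) rs → All (λ r′ → Disjoint (orbit _) (orbit r′)) rs
    disjoint-from []               []           = []
    disjoint-from (lead′ ∷ leads′) (r≢r′ ∷ r≢) = leaders-disjoint lead lead′ r≢r′ ∷ disjoint-from leads′ r≢

  cycleFactor : CycleFactor D
  cycleFactor = map orbit-cycle leaders
    , subst (Unique ∘ concat) orbits≡ orbits-unique
    , λ v → subst ((v ∈_) ∘ concat) orbits≡ (orbits-cover v)
    where
    -- cycleVertices (orbit-cycle v) is orbit v by definition, as period v is a successor.
    orbits≡ : map orbit leaders ≡ map cycleVertices (map orbit-cycle leaders)
    orbits≡ = map-∘ {g = cycleVertices} {f = orbit-cycle} leaders
    orbits-unique : Unique (concat (map orbit leaders))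
    orbits-unique = concat⁺ (Allₚ.map⁺ (All.tabulate (λ {v} _ → orbit-unique v)))
      (AllPairs.map⁺ (leaders-pairwise-disjoint (Allₚ.all-filter leader? (allFin n)) (filter⁺ leader? (allFin⁺ n))))
    orbits-cover : ∀ v → v ∈ concat (map orbit leaders)
    -- let rather than with: abstracting over leader-of v makes Agda normalise leaders.
    orbits-cover v = let r , lead , v∈r = leader-of v in
      ∈-concat⁺′ v∈r (∈-map⁺ orbit (∈-filter⁺ leader? (∈-allFin r) lead))

-- The degree condition implies Hall's condition

reach-out : ∀ {n} {D : Digraph n} {x y} → Reach D x y → x ≢ y → ∃[ z ] Arc D x z
reach-out here          x≢x = contradiction refl x≢x
reach-out (there xz _)  _   = _ , xz

reach-in : ∀ {n} {D : Digraph n} {x y} → Reach D x y → x ≢ y → ∃[ w ] Arc D w y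
reach-in here                      x≢x = contradiction refl x≢x
reach-in {x = x} {y} (there {y = z} xz zy) x≢y with z ≟ y
... | yes refl = x , xz
... | no z≢y   = reach-in zy z≢y

m∸n≤o⇒m≤o+n : ∀ m n o → n ≤ m → m ∸ n ≤ o → m ≤ o + n
m∸n≤o⇒m≤o+n m n o n≤m m∸n≤o = subst (_≤ o + n) (m∸n+n≡m n≤m) (+-monoˡ-≤ n m∸n≤o)

module DegreeCondition {n a : ℕ} (D : Digraph n) (P : Fin n → Bool) (4≤a : 4 ≤ a)
  (|P| : count P ≡ a) (|R| : count (not ∘ P) ≡ a)
  (crossing : ∀ x y → Arc D x y → P y ≡ not (P x))
  (has-out : ∀ x → ∃[ y ] Arc D x y) (has-in : ∀ y → ∃[ x ] Arc D x y)
  (dominating : ∀ x y → DominatingPair D x y → (a + a) ∸ 2 ≤ deg D x ⊔ deg D y) where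

  open Hall (adj D) using (N; N-intro; N-⊆; HallCondition)

  R : Fin n → Bool
  R = not ∘ P

  arc-from-P : ∀ {x y} → Arc D x y → P x ≡ true → R y ≡ true
  arc-from-P {x} {y} xy px rewrite crossing x y xy | px = refl

  arc-to-P : ∀ {x y} → Arc D x y → P y ≡ true → R x ≡ true
  arc-to-P {x} {y} xy py = trans (sym (crossing x y xy)) py

  arc-to-R : ∀ {x y} → Arc D x y → R y ≡ true → P x ≡ true
  arc-to-R {x} {y} xy ry = trans (sym (Bool.not-involutive (P x))) (trans (cong not (sym (crossing x y xy))) ry)

  arc-from-R : ∀ {x y} → Arc D x y → R x ≡ true → P y ≡ true
  arc-from-R {x} {y} xy rx = trans (crossing x y xy) rx

  outdeg-≤ : ∀ {x} (S : Fin n → Bool) → (∀ {y} → Arc D x y → S y ≡ true) → outdeg D x ≤ count S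
  outdeg-≤ S into = count-mono _ S (λ y → into)

  indeg-≤ : ∀ {y} (S : Fin n → Bool) → (∀ {x} → Arc D x y → S x ≡ true) → indeg D y ≤ count S
  indeg-≤ S from = count-mono _ S (λ x → from)

  threshold : ℕ
  threshold = (a + a) ∸ 2

  2≤a+a : 2 ≤ a + a
  2≤a+a = let 1≤a = ≤-trans (s≤s z≤n) 4≤a in +-mono-≤ 1≤a 1≤a

  module Deficient (Q : Fin n → Bool) (Q⊆P : Q ⊆ᵇ P) (|NQ|<|Q| : count (N R Q) < count Q) where

    NQ Y : Fin n → Bool
    NQ = N R Q
    Y  = R ∖ NQ

    |P|≡|Q|+|P∖Q| : a ≡ count Q + count (P ∖ Q)
    |P|≡|Q|+|P∖Q| = trans (sym |P|) (count-⊆ Q P Q⊆P)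

    |R|≡|NQ|+|Y| : a ≡ count NQ + count Y
    |R|≡|NQ|+|Y| = trans (sym |R|) (count-⊆ NQ R (N-⊆ R Q))

    Y-in-neighbour : ∀ {x y} → Y y ≡ true → Arc D x y → (P ∖ Q) x ≡ true
    Y-in-neighbour {x} {y} y∈Y xy with Q x in qx | ∖-elim R NQ y∈Y
    ... | true  | ry , y∉NQ = contradiction (trans (sym y∉NQ) (N-intro R Q ry qx xy)) λ ()
    ... | false | ry , _    = arc-to-R xy ry

    indeg-Y : ∀ {y} → Y y ≡ true → indeg D y ≤ count (P ∖ Q)
    indeg-Y y∈Y = indeg-≤ (P ∖ Q) (Y-in-neighbour y∈Y)

    outdeg-Y : ∀ {y} → Y y ≡ true → outdeg D y ≤ a
    outdeg-Y y∈Y = subst (_ ≤_) |P| (outdeg-≤ P (λ xy → arc-from-R xy (proj₁ (∖-elim R NQ y∈Y))))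

    0<|Y| : 0 < count Y
    0<|Y| = +-cancelˡ-< (count NQ) 0 (count Y) (begin-strict
      count NQ + 0      ≡⟨ +-identityʳ (count NQ) ⟩
      count NQ          <⟨ |NQ|<|Q| ⟩
      count Q           ≤⟨ m≤m+n (count Q) (count (P ∖ Q)) ⟩
      count Q + count (P ∖ Q) ≡⟨ |P|≡|Q|+|P∖Q| ⟨
      a                 ≡⟨ |R|≡|NQ|+|Y| ⟩
      count NQ + count Y ∎)
      where open ≤-Reasoning

    0<|P∖Q| : 0 < count (P ∖ Q)
    0<|P∖Q| = let y , y∈Y = count-witness Y 0<|Y| ; x , xy = has-in y in
      count-pos (P ∖ Q) (Y-in-neighbour y∈Y xy)

    |NQ|+2≤a : count NQ + 2 ≤ a
    |NQ|+2≤a = begin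
      count NQ + 2             ≡⟨ +-comm (count NQ) 2 ⟩
      suc (suc (count NQ))     ≤⟨ s≤s |NQ|<|Q| ⟩
      suc (count Q)            ≡⟨ +-comm 1 (count Q) ⟩
      count Q + 1              ≤⟨ +-monoʳ-≤ (count Q) 0<|P∖Q| ⟩
      count Q + count (P ∖ Q)  ≡⟨ |P|≡|Q|+|P∖Q| ⟨
      a                        ∎
      where open ≤-Reasoning

    2≤|Y| : 2 ≤ count Y
    2≤|Y| = +-cancelˡ-≤ (count NQ) 2 (count Y) (subst (count NQ + 2 ≤_) |R|≡|NQ|+|Y| |NQ|+2≤a)

    module AboveThreshold {x} (qx : Q x ≡ true) (threshold≤deg : threshold ≤ deg D x) where

      px : P x ≡ true
      px = Q⊆P x qx

      outdeg-x : outdeg D x ≤ count NQ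
      outdeg-x = outdeg-≤ NQ (λ xy → N-intro R Q (arc-from-P xy px) qx xy)

      indeg-x : indeg D x ≤ a
      indeg-x = subst (_ ≤_) |R| (indeg-≤ R (λ wx → arc-to-P wx px))

      a+a≤|NQ|+indeg+2 : a + a ≤ count NQ + indeg D x + 2
      a+a≤|NQ|+indeg+2 = ≤-trans (m∸n≤o⇒m≤o+n (a + a) 2 (deg D x) 2≤a+a threshold≤deg)
                                  (+-monoˡ-≤ 2 (+-monoˡ-≤ (indeg D x) outdeg-x))

      a≤indeg-x : a ≤ indeg D x
      a≤indeg-x = +-cancelˡ-≤ a a (indeg D x) (begin
        a + a                           ≤⟨ a+a≤|NQ|+indeg+2 ⟩
        count NQ + indeg D x + 2        ≡⟨ xy∙z≈xz∙y +-commutativeSemigroup (count NQ) (indeg D x) 2 ⟩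
        count NQ + 2 + indeg D x        ≤⟨ +-monoˡ-≤ (indeg D x) |NQ|+2≤a ⟩
        a + indeg D x                   ∎)
        where open ≤-Reasoning

      |P∖Q|≤1 : count (P ∖ Q) ≤ 1
      |P∖Q|≤1 = +-cancelˡ-≤ (count Q) (count (P ∖ Q)) 1 (begin
        count Q + count (P ∖ Q)   ≡⟨ |P|≡|Q|+|P∖Q| ⟨
        a                         ≤⟨ +-cancelʳ-≤ a a (count NQ + 2) (begin
          a + a                       ≤⟨ a+a≤|NQ|+indeg+2 ⟩
          count NQ + indeg D x + 2    ≤⟨ +-monoˡ-≤ 2 (+-monoʳ-≤ (count NQ) indeg-x) ⟩
          count NQ + a + 2            ≡⟨ xy∙z≈xz∙y +-commutativeSemigroup (count NQ) a 2 ⟩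
          count NQ + 2 + a            ∎) ⟩
        count NQ + 2              ≡⟨ +-comm (count NQ) 2 ⟩
        suc (suc (count NQ))      ≤⟨ s≤s |NQ|<|Q| ⟩
        suc (count Q)             ≡⟨ +-comm 1 (count Q) ⟩
        count Q + 1               ∎)
        where open ≤-Reasoning

      R⇉x : ∀ {y} → R y ≡ true → Arc D y x
      R⇉x {y} = count-≤⇒⊇ (λ y → adj D y x) R (λ y yx → arc-to-P yx px)
                  (subst (_≤ indeg D x) (sym |R|) a≤indeg-x) y

      deg-Y : ∀ {y} → Y y ≡ true → deg D y ≤ a + 1
      deg-Y y∈Y = +-mono-≤ (outdeg-Y y∈Y) (≤-trans (indeg-Y y∈Y) |P∖Q|≤1)

    deg-below-threshold : ∀ {x} → Q x ≡ true → ¬ (threshold ≤ deg D x)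
    deg-below-threshold {x} qx threshold≤deg with count-two Y 2≤|Y|
    ... | y₁ , y₂ , y₁≢y₂ , y₁∈Y , y₂∈Y = <⇒≱ 4≤a (+-cancelˡ-≤ a a 3 (subst (a + a ≤_) (+-assoc a 1 2)
      (m∸n≤o⇒m≤o+n (a + a) 2 (a + 1) 2≤a+a (≤-trans threshold≤deg-Y (⊔-lub (deg-Y y₁∈Y) (deg-Y y₂∈Y))))))
      where
      open AboveThreshold qx threshold≤deg
      threshold≤deg-Y : threshold ≤ deg D y₁ ⊔ deg D y₂
      threshold≤deg-Y = dominating y₁ y₂
        (y₁≢y₂ , x , R⇉x (proj₁ (∖-elim R NQ y₁∈Y)) , R⇉x (proj₁ (∖-elim R NQ y₂∈Y)))

    successor : Fin n → Fin n
    successor x = proj₁ (has-out x)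

    max-deg-below-threshold : ∀ {x₁ x₂} → Q x₁ ≡ true → Q x₂ ≡ true → ¬ (threshold ≤ deg D x₁ ⊔ deg D x₂)
    max-deg-below-threshold {x₁} {x₂} q₁ q₂ threshold≤max with ⊔-sel (deg D x₁) (deg D x₂)
    ... | inj₁ max≡₁ = deg-below-threshold q₁ (subst (threshold ≤_) max≡₁ threshold≤max)
    ... | inj₂ max≡₂ = deg-below-threshold q₂ (subst (threshold ≤_) max≡₂ threshold≤max)

    successor-injective : ∀ x₁ x₂ → Q x₁ ≡ true → Q x₂ ≡ true → successor x₁ ≡ successor x₂ → x₁ ≡ x₂
    successor-injective x₁ x₂ q₁ q₂ eq with x₁ ≟ x₂
    ... | yes x₁≡x₂ = x₁≡x₂
    ... | no x₁≢x₂ = contradiction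
      (dominating x₁ x₂ (x₁≢x₂ , successor x₁ , proj₂ (has-out x₁) , subst (Arc D x₂) (sym eq) (proj₂ (has-out x₂))))
      (max-deg-below-threshold q₁ q₂)

  hall-condition : HallCondition P R
  hall-condition Q Q⊆P = ≮⇒≥ λ |NQ|<|Q| → let open Deficient Q Q⊆P |NQ|<|Q| in
    <⇒≱ |NQ|<|Q| (count-injective Q NQ successor
      (λ x qx → N-intro R Q (arc-from-P (proj₂ (has-out x)) (Q⊆P x qx)) qx (proj₂ (has-out x)))
      successor-injective)

-- Balanced bipartite digraphs

module _ {n : ℕ} (D : Digraph n) (side : Fin n → Bool) where

  perfectMatchings⇒cycleFactor : PerfectMatchingFrom D side true → PerfectMatchingFrom D side false → CycleFactor D
  perfectMatchings⇒cycleFactor (f , maps , injective) (g , maps′ , injective′) =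
    Successor.cycleFactor D σ σ-arc σ-injective
    where
    σ : Fin n → Fin n
    σ x = if side x then f x else g x

    σ-arc : ∀ x → Arc D x (σ x)
    σ-arc x with side x in sx
    ... | true  = proj₁ (maps x sx)
    ... | false = proj₁ (maps′ x sx)

    apart : ∀ {x y} → side x ≡ true → side y ≡ false → f x ≢ g y
    apart {x} {y} sx sy fx≡gy = proj₂ (maps′ y sy)
      (trans (cong side (sym fx≡gy)) (Bool.¬-not (proj₂ (maps x sx))))

    σ-injective : Injective _≡_ _≡_ σ
    σ-injective {x} {y} σx≡σy with side x in sx | side y in sy
    ... | true  | true  = injective x y sx sy σx≡σy
    ... | false | false = injective′ x y sx sy σx≡σy
    ... | true  | false = contradiction σx≡σy (apart sx sy)
    ... | false | true  = contradiction (sym σx≡σy) (apart sy sx)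

module Sides {a : ℕ} {D : Digraph (a + a)} {side : Fin (a + a) → Bool} (bb : BalancedBipartite D a side) where
  open BalancedBipartite bb

  onSide : Bool → Fin (a + a) → Bool
  onSide s x = if s then side x else not (side x)

  onSide-intro : ∀ s {x} → side x ≡ s → onSide s x ≡ true
  onSide-intro true  sx = sx
  onSide-intro false sx = cong not sx

  onSide-elim : ∀ s {x} → onSide s x ≡ true → side x ≡ s
  onSide-elim true  h = h
  onSide-elim false {x} h = trans (sym (Bool.not-involutive (side x))) (cong not h)

  offSide : ∀ s {x} → not (onSide s x) ≡ true → side x ≢ s
  offSide s h sx = contradiction (trans (sym h) (cong not (onSide-intro s sx))) λ ()

  crossing : ∀ s x y → Arc D x y → onSide s y ≡ not (onSide s x)
  crossing true  x y xy = Bool.¬-not (bipart x y xy ∘ sym)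
  crossing false x y xy = cong not (crossing true x y xy)

  |not∘side| : count (not ∘ side) ≡ a
  |not∘side| = trans (count-cong _ _ not≗if) sizeY
    where
    not≗if : ∀ v → not (side v) ≡ (if side v then false else true)
    not≗if v with side v
    ... | true  = refl
    ... | false = refl

  |onSide| : ∀ s → count (onSide s) ≡ a
  |onSide| true  = sizeX
  |onSide| false = |not∘side|

  |offSide| : ∀ s → count (not ∘ onSide s) ≡ a
  |offSide| true  = |not∘side|
  |offSide| false = trans (count-cong _ side (Bool.not-involutive ∘ side)) sizeX

  opposite : 0 < a → ∀ x → ∃[ y ] side x ≢ side y
  opposite 0<a x = let y , y∈ = count-witness (onSide (not (side x))) (subst (0 <_) (sym (|onSide| _)) 0<a) in
    y , λ sx≡sy → Bool.not-¬ refl (trans sx≡sy (onSide-elim (not (side x)) y∈))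

  out-arc : StronglyConnected D → 0 < a → ∀ x → ∃[ y ] Arc D x y
  out-arc strong 0<a x = let y , x≢y = opposite 0<a x in reach-out (strong x y) (x≢y ∘ cong side)

  in-arc : StronglyConnected D → 0 < a → ∀ y → ∃[ x ] Arc D x y
  in-arc strong 0<a y = let x , y≢x = opposite 0<a y in reach-in (strong x y) (y≢x ∘ cong side ∘ sym)

  perfectMatching : ∀ s → Hall.Matching (adj D) (onSide s) (not ∘ onSide s) → PerfectMatchingFrom D side s
  perfectMatching s (f , maps , injective) =
      f
    , (λ x sx → let r , e = maps x (onSide-intro s sx) in e , offSide s r)
    , (λ x x′ sx sx′ → injective x x′ (onSide-intro s sx) (onSide-intro s sx′))

lemma4p3 : ∀ (a : ℕ) (D : Digraph (a + a)) (side : Fin (a + a) → Bool) →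
    4 ≤ a →
    BalancedBipartite D a side →
    StronglyConnected D →
    (∀ x y → DominatingPair D x y → (a + a) ∸ 2 ≤ deg D x ⊔ deg D y) →
    PerfectMatchingFrom D side true × PerfectMatchingFrom D side false × CycleFactor D
lemma4p3 a D side 4≤a bb strong dominating =
  matching true , matching false , perfectMatchings⇒cycleFactor D side (matching true) (matching false)
  where
  open Sides bb
  0<a : 0 < a
  0<a = ≤-trans (s≤s z≤n) 4≤a
  matching : ∀ s → PerfectMatchingFrom D side s
  matching s = perfectMatching s (Hall.hall-theorem (adj D)
    (DegreeCondition.hall-condition D (onSide s) 4≤a (|onSide| s) (|offSide| s) (crossing s)
      (out-arc strong 0<a) (in-arc strong 0<a) dominating))
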